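{- If $G$ is a graph with no vertex of degree one, then $nevc(G)=mvc(G)$.
   Context: $mvc(G)$ is the size of a minimum vertex cover of $G$. New eternal vertex cover game on $G$: a defender first places guards on vertices, at most one per vertex. In each round an attacker attacks an edge; in response each guard may move along a walk of at most two edges without retracing (it may not return along the edge it just used), and at least one guard on an endpoint of the attacked edge must traverse the attacked edge as its first step. Several guards may pass through a vertex during the move, but afterwards there is at most one guard per vertex. If no valid response exists the attacker wins; the defender wins if she can respond to every attack of an infinite sequence. $nevc(G)$ is the minimum number of guards for which the defender has a winning strategy. -}

module Defs where

open import Data.Nat using (ℕ; _≤_)
open import Data.Bool using (Bool; true; false)
open import Data.Fin using (Fin)
open import Data.Fin.Subset using (Subset; _∈_; ∣_∣)
open import Data.List using (length; filterᵇ; allFin)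
open import Data.Product using (Σ; ∃; _×_)
open import Data.Sum using (_⊎_)
open import Relation.Nullary using (¬_)
open import Relation.Binary.PropositionalEquality using (_≡_; _≢_)
open import Function.Definitions using (Injective)

record Graph (n : ℕ) : Set where
  field
    adj    : Fin n → Fin n → Bool
    adj-sym    : ∀ u v → adj u v ≡ adj v u
    adj-irrefl : ∀ v → adj v v ≡ false
open Graph public

module _ {n : ℕ} (G : Graph n) where

  E : Fin n → Fin n → Set
  E u v = adj G u v ≡ true

  degree : Fin n → ℕ
  degree v = length (filterᵇ (adj G v) (allFin n))

  IsVertexCover : Subset n → Set
  IsVertexCover C = ∀ u v → E u v → (u ∈ C) ⊎ (v ∈ C)

  IsMVC : ℕ → Set
  IsMVC m = (Σ (Subset n) λ C → IsVertexCover C × ∣ C ∣ ≡ m)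
          × (∀ C → IsVertexCover C → m ≤ ∣ C ∣)

  -- A guard's move: a walk of at most two edges, without retracing
  -- (a two-edge walk u–v–w must have w ≠ u).
  data Walk : Fin n → Fin n → Set where
    stay : ∀ {u} → Walk u u
    one  : ∀ {u v} → E u v → Walk u v
    two  : ∀ {u v w} → E u v → E v w → w ≢ u → Walk u w

  data FirstStep (a b : Fin n) : ∀ {u w} → Walk u w → Set where
    one-first : (e : E a b) → FirstStep a b (one e)
    two-first : ∀ {w} (e : E a b) (e' : E b w) (ne : w ≢ a) → FirstStep a b (two e e' ne)

  -- A configuration of k (labelled) guards; valid configurations are injective
  -- (at most one guard per vertex).
  Config : ℕ → Set
  Config k = Fin k → Fin n

  Response : ∀ {k} → Config k → Fin n → Fin n → Config k → Set
  Response {k} f x y g =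
    Σ ((i : Fin k) → Walk (f i) (g i)) λ walks →
      Injective _≡_ _≡_ g
      × ∃ λ i → FirstStep x y (walks i) ⊎ FirstStep y x (walks i)

  -- The defender has a winning strategy with k guards: there is a set P of
  -- positions containing an admissible initial placement, from each of which
  -- every attack has a valid response leading back into P.
  Wins : ℕ → Set₁
  Wins k = Σ (Config k → Set) λ P →
             (∃ λ f → Injective _≡_ _≡_ f × P f)
           × (∀ f → P f → ∀ x y → E x y → ∃ λ g → Response f x y g × P g)

  IsNEVC : ℕ → Set₁
  IsNEVC m = Wins m × (∀ k → Wins k → m ≤ k)

  NoDegreeOne : Set
  NoDegreeOne = ∀ v → ¬ (degree v ≡ 1)

-- A defender with k guards must start on a vertex cover, since every attack is
-- answered by a guard standing on an endpoint of the attacked edge; so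
-- mvc(G) ≤ nevc(G). Conversely, guards on a vertex cover can keep the set of
-- occupied vertices unchanged. When xy is attacked and a guard stands on x,
-- either y is guarded and the two guards swap along xy, or y is unguarded;
-- then y, having degree at least two, has a neighbour w ≠ x, which must be
-- guarded because yw is covered, and the guards on x and w exchange places
-- along the two-edge walks x–y–w and w–y–x.
module Submission where

open import Defs
open import Data.Nat using (ℕ; zero; suc; _≤_; _+_; z≤n; s≤s)
open import Data.Nat.Properties using (≤-trans; ≤-reflexive; +-monoʳ-≤; +-suc)
open import Data.Bool using (Bool; true; T; T?) renaming (_≟_ to _≟ᵇ_)
open import Data.Bool.Properties using (T-≡)
open import Data.Fin using (Fin; zero; suc; _≟_)
open import Data.Fin.Properties using (any?; suc-injective; 0≢1+n)
open import Data.Fin.Permutation.Components using (transpose; transpose-inverse)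
open import Data.Fin.Subset using (Subset; _∈_; ∣_∣; ⊥; ⁅_⁆; _∪_; inside; outside)
open import Data.Fin.Subset.Properties
  using (∣p∣≤∣x∷p∣; ∣⊥∣≡0; ∣⁅x⁆∣≡1; x∈⁅x⁆; x∈p∪q⁺)
open import Data.List using (length; filterᵇ; tabulate)
open import Data.List.Properties using (filter-accept; filter-reject; filter-none)
open import Data.List.Relation.Unary.All.Properties using (tabulate⁺)
open import Data.Product using (Σ; ∃; _×_; _,_; proj₁; proj₂)
open import Data.Sum using (_⊎_; inj₁; inj₂)
import Data.Sum as Sum
open import Data.Vec using (_∷_; [])
open import Data.Vec.Base using (here; there)
open import Function using (_∘_; id)
open import Function.Bundles using (Equivalence)
open import Function.Definitions using (Injective)
open import Relation.Nullary using (yes; no; ¬?; contradiction)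
open import Relation.Nullary.Decidable using (_×-dec_)
open import Relation.Binary.PropositionalEquality

transpose-injective : ∀ {k} (i j : Fin k) → Injective _≡_ _≡_ (transpose i j)
transpose-injective i j eq =
  trans (sym (transpose-inverse j i)) (trans (cong (transpose j i) eq) (transpose-inverse j i))

module _ {a r} {A : Set a} (R : A → A → Set r) (R-refl : ∀ {x} → R x x)
         {k} (f : Fin k → A) {i j : Fin k} (rij : R (f i) (f j)) (rji : R (f j) (f i)) where

  relate-transpose : ∀ t → R (f t) (f (transpose i j t))
  relate-transpose t with t ≟ i
  ... | yes refl = rij
  ... | no _ with t ≟ j
  ...   | yes refl = rji
  ...   | no _     = R-refl

  -- Needed because relate-transpose i does not reduce to rij: i ≟ i is stuck on a variable.
  relate-transpose-at-i : ∀ {p} (P : ∀ {v} → R (f i) v → Set p) → P rij → P (relate-transpose i)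
  relate-transpose-at-i P p with i ≟ i
  ... | yes refl = p
  ... | no i≢i   = contradiction refl i≢i

∣p∪q∣≤∣p∣+∣q∣ : ∀ {n} (p q : Subset n) → ∣ p ∪ q ∣ ≤ ∣ p ∣ + ∣ q ∣
∣p∪q∣≤∣p∣+∣q∣ []            []            = z≤n
∣p∪q∣≤∣p∣+∣q∣ (inside  ∷ p) (s       ∷ q) =
  s≤s (≤-trans (∣p∪q∣≤∣p∣+∣q∣ p q) (+-monoʳ-≤ ∣ p ∣ (∣p∣≤∣x∷p∣ s q)))
∣p∪q∣≤∣p∣+∣q∣ (outside ∷ p) (outside ∷ q) = ∣p∪q∣≤∣p∣+∣q∣ p q
∣p∪q∣≤∣p∣+∣q∣ (outside ∷ p) (inside  ∷ q) =
  ≤-trans (s≤s (∣p∪q∣≤∣p∣+∣q∣ p q)) (≤-reflexive (sym (+-suc ∣ p ∣ ∣ q ∣)))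

image : ∀ {n k} → (Fin k → Fin n) → Subset n
image {k = zero}  f = ⊥
image {k = suc k} f = ⁅ f zero ⁆ ∪ image (f ∘ suc)

∣image∣≤k : ∀ {n k} (f : Fin k → Fin n) → ∣ image f ∣ ≤ k
∣image∣≤k {n} {zero}  f = ≤-reflexive (∣⊥∣≡0 n)
∣image∣≤k {n} {suc k} f = begin
  ∣ ⁅ f zero ⁆ ∪ image (f ∘ suc) ∣      ≤⟨ ∣p∪q∣≤∣p∣+∣q∣ ⁅ f zero ⁆ (image (f ∘ suc)) ⟩
  ∣ ⁅ f zero ⁆ ∣ + ∣ image (f ∘ suc) ∣  ≡⟨ cong (_+ ∣ image (f ∘ suc) ∣) (∣⁅x⁆∣≡1 (f zero)) ⟩
  suc ∣ image (f ∘ suc) ∣               ≤⟨ s≤s (∣image∣≤k (f ∘ suc)) ⟩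
  suc k                                 ∎
  where open Data.Nat.Properties.≤-Reasoning

∈-image : ∀ {n k} (f : Fin k → Fin n) i → f i ∈ image f
∈-image f zero    = x∈p∪q⁺ (inj₁ (x∈⁅x⁆ (f zero)))
∈-image f (suc i) = x∈p∪q⁺ (inj₂ (∈-image (f ∘ suc) i))

enumerate : ∀ {n} (C : Subset n) → Fin ∣ C ∣ → Fin n
enumerate (inside  ∷ C) zero    = zero
enumerate (inside  ∷ C) (suc i) = suc (enumerate C i)
enumerate (outside ∷ C) i       = suc (enumerate C i)

enumerate-injective : ∀ {n} (C : Subset n) → Injective _≡_ _≡_ (enumerate C)
enumerate-injective (inside  ∷ C) {zero}  {zero}  eq = refl
enumerate-injective (inside  ∷ C) {suc s} {suc t} eq =
  cong suc (enumerate-injective C (suc-injective eq))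
enumerate-injective (outside ∷ C)                 eq = enumerate-injective C (suc-injective eq)

enumerate-surjective : ∀ {n} (C : Subset n) {v} → v ∈ C → ∃ λ i → enumerate C i ≡ v
enumerate-surjective (inside  ∷ C) here      = zero , refl
enumerate-surjective (inside  ∷ C) (there p) =
  let i , eq = enumerate-surjective C p in suc i , cong suc eq
enumerate-surjective (outside ∷ C) (there p) =
  let i , eq = enumerate-surjective C p in i , cong suc eq

length-filterᵇ-tabulate-unique :
  ∀ {a} {A : Set a} {k} (h : Fin k → A) (q : A → Bool) {x} →
  T (q (h x)) → (∀ t → T (q (h t)) → t ≡ x) → length (filterᵇ q (tabulate h)) ≡ 1
length-filterᵇ-tabulate-unique {k = suc k} h q {zero} qx unique = begin
  length (filterᵇ q (tabulate h))               ≡⟨ cong length (filter-accept (T? ∘ q) qx) ⟩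
  suc (length (filterᵇ q (tabulate (h ∘ suc)))) ≡⟨ cong (suc ∘ length) (filter-none (T? ∘ q) none) ⟩
  1                                             ∎
  where
  open ≡-Reasoning
  none = tabulate⁺ λ t qt → 0≢1+n (sym (unique (suc t) qt))
length-filterᵇ-tabulate-unique {k = suc k} h q {suc x} qx unique =
  trans (cong length (filter-reject (T? ∘ q) λ q0 → 0≢1+n (unique zero q0)))
        (length-filterᵇ-tabulate-unique (h ∘ suc) q qx (λ t qt → suc-injective (unique (suc t) qt)))

module _ {n} (G : Graph n) where

  E-sym : ∀ {u v} → E G u v → E G v u
  E-sym {u} {v} e = trans (adj-sym G v u) e

  another-neighbour : NoDegreeOne G → ∀ {y x} → E G y x → ∃ λ w → E G y w × w ≢ x
  another-neighbour noDeg1 {y} {x} yx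
    with any? (λ w → (adj G y w ≟ᵇ true) ×-dec ¬? (w ≟ x))
  ... | yes found = found
  ... | no none   = contradiction degree≡1 (noDeg1 y)
    where
    only-x : ∀ w → T (adj G y w) → w ≡ x
    only-x w yw with w ≟ x
    ... | yes w≡x = w≡x
    ... | no  w≢x = contradiction (w , Equivalence.to T-≡ yw , w≢x) none
    degree≡1 : degree G y ≡ 1
    degree≡1 = length-filterᵇ-tabulate-unique id (adj G y) (Equivalence.from T-≡ yx) only-x

  Occupied : ∀ {k} → Config G k → Fin n → Set
  Occupied f v = ∃ λ i → f i ≡ v

  Covering : ∀ {k} → Config G k → Set
  Covering f = ∀ x y → E G x y → Occupied f x ⊎ Occupied f y

  Guarding : ∀ {k} → Config G k → Set
  Guarding f = Injective _≡_ _≡_ f × Covering f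

  FirstStep-source : ∀ {a b u w} {p : Walk G u w} → FirstStep G a b p → u ≡ a
  FirstStep-source (one-first _)     = refl
  FirstStep-source (two-first _ _ _) = refl

  Response-occupied : ∀ {k} {f g : Config G k} {x y} →
                      Response G f x y g → Occupied f x ⊎ Occupied f y
  Response-occupied (_ , _ , i , first) =
    Sum.map (λ fs → i , FirstStep-source fs) (λ fs → i , FirstStep-source fs) first

  Response-sym : ∀ {k} {f g : Config G k} {x y} → Response G f x y g → Response G f y x g
  Response-sym (walks , injective , i , first) = walks , injective , i , Sum.swap first

  wins⇒vertexCover : ∀ {k} → Wins G k → Σ (Subset n) λ C → IsVertexCover G C × ∣ C ∣ ≤ k
  wins⇒vertexCover (P , (f , _ , Pf) , strategy) = image f , cover , ∣image∣≤k f
    where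
    in-image : ∀ {v} → Occupied f v → v ∈ image f
    in-image (i , refl) = ∈-image f i
    cover : IsVertexCover G (image f)
    cover x y xy =
      Sum.map in-image in-image (Response-occupied (proj₁ (proj₂ (strategy f Pf x y xy))))

  module _ {k} (f : Config G k) (guarding : Guarding f) where

    transpose-guarding : ∀ i j → Guarding (f ∘ transpose i j)
    transpose-guarding i j = transpose-injective i j ∘ proj₁ guarding , covering
      where
      occupied : ∀ {v} → Occupied f v → Occupied (f ∘ transpose i j) v
      occupied (t , refl) = transpose j i t , cong f (transpose-inverse i j)
      covering : Covering (f ∘ transpose i j)
      covering x y xy = Sum.map occupied occupied (proj₂ guarding x y xy)

    exchange : ∀ {a b i j} (w : Walk G (f i) (f j)) → Walk G (f j) (f i) → FirstStep G a b w →
               ∃ λ g → Response G f a b g × Guarding g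
    exchange {a} {b} {i} {j} wi wj first =
      f ∘ transpose i j ,
      (walks , proj₁ (transpose-guarding i j) , i , first-at-i) ,
      transpose-guarding i j
      where
      walks : ∀ t → Walk G (f t) (f (transpose i j t))
      walks = relate-transpose (Walk G) stay f wi wj
      first-at-i : FirstStep G a b (walks i) ⊎ FirstStep G b a (walks i)
      first-at-i = relate-transpose-at-i (Walk G) stay f wi wj
                     (λ w → FirstStep G a b w ⊎ FirstStep G b a w) (inj₁ first)

    respond-from : NoDegreeOne G → ∀ i {y} → E G (f i) y →
                   ∃ λ g → Response G f (f i) y g × Guarding g
    respond-from noDeg1 i {y} xy with any? (λ j → f j ≟ y)
    ... | yes (j , refl) = exchange (one xy) (one (E-sym xy)) (one-first xy)
    ... | no unoccupied with another-neighbour noDeg1 (E-sym xy)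
    ...   | w , yw , w≢x with proj₂ guarding y w yw
    ...     | inj₁ occupied   = contradiction occupied unoccupied
    ...     | inj₂ (j , refl) =
      exchange (two xy yw w≢x) (two (E-sym yw) (E-sym xy) (w≢x ∘ sym)) (two-first xy yw w≢x)

    respond : NoDegreeOne G → ∀ x y → E G x y → ∃ λ g → Response G f x y g × Guarding g
    respond noDeg1 x y xy with proj₂ guarding x y xy
    ... | inj₁ (i , refl) = respond-from noDeg1 i xy
    ... | inj₂ (i , refl) =
      let g , r , guarding-g = respond-from noDeg1 i (E-sym xy) in g , Response-sym r , guarding-g

  vertexCover⇒wins : NoDegreeOne G → ∀ {C} → IsVertexCover G C → Wins G ∣ C ∣
  vertexCover⇒wins noDeg1 {C} cover =
    Guarding , (enumerate C , proj₁ guarding , guarding) ,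
    λ f guarding-f → respond f guarding-f noDeg1
    where
    guarding : Guarding (enumerate C)
    guarding = enumerate-injective C ,
               λ x y xy → Sum.map (enumerate-surjective C) (enumerate-surjective C) (cover x y xy)

lemma21 : ∀ {n} (G : Graph n) → NoDegreeOne G → ∀ m → IsMVC G m → IsNEVC G m
lemma21 G noDeg1 m ((C , cover , ∣C∣≡m) , minimal) =
  subst (Wins G) ∣C∣≡m (vertexCover⇒wins G noDeg1 cover) ,
  λ k wins → let C′ , cover′ , ∣C′∣≤k = wins⇒vertexCover G wins
             in ≤-trans (minimal C′ cover′) ∣C′∣≤k
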